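{- For every integer $k\ge1$, the diagonal game $\widehat{\mathsf{G}}_5[k]$ has exactly $k$ Nash equilibria; each of them is Pareto-Optimal, Strongly Pareto-Optimal and symmetric, and yields utility $1$ to each player.
   Context: $\mathsf{D}_k$ is the $k\times k$ $0/1$ matrix with $\mathsf{D}_k[i,j]=1$ iff $i\le j$. The diagonal game $\widehat{\mathsf{G}}_5[k]$ is the bimatrix game $\langle\mathsf{D}_k,\mathsf{D}_k^{\mathrm T}\rangle$ (row player's utility on $\langle i,j\rangle$ is $\mathsf{D}_k[i,j]$, column player's is $\mathsf{D}_k^{\mathrm T}[i,j]$). Nash equilibria are mixed. A Nash equilibrium is symmetric if both players use the same mixed strategy. It is Pareto-Optimal if no mixed profile makes some player strictly better off and every player at least as well off; it is Strongly Pareto-Optimal if for every mixed profile $\widehat{\bm\sigma}$ in which some player is strictly better off, some player $j$ whose mixed strategy differs in $\widehat{\bm\sigma}$ is not strictly better off.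
   Formalization: Mixed strategies have rational probabilities, so the Nash equilibria, the unilateral deviations and the competing profiles in Pareto-Optimality and Strong Pareto-Optimality range over rational mixed profiles. -}

module Defs where

open import Data.Nat using (ℕ; zero; suc)
import Data.Nat as ℕ
open import Data.Fin using (Fin; zero; suc; toℕ)
open import Data.Rational using (ℚ; 0ℚ; 1ℚ; _+_; _*_; _≤_; _<_)
open import Data.Product using (Σ; ∃; _×_; _,_)
open import Data.Sum using (_⊎_)
open import Relation.Nullary using (¬_; yes; no)
open import Relation.Binary.PropositionalEquality using (_≡_)

sumFin : ∀ {k} → (Fin k → ℚ) → ℚ
sumFin {zero}  f = 0ℚ
sumFin {suc k} f = f zero + sumFin (λ i → f (suc i))

D : ∀ k → Fin k → Fin k → ℚ
D k i j with toℕ i ℕ.≤? toℕ j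
... | yes _ = 1ℚ
... | no  _ = 0ℚ

data Player : Set where
  rowP colP : Player

-- Payoff of the diagonal game Ĝ₅[k] = ⟨ D_k , D_kᵀ ⟩ at pure profile ⟨i,j⟩
payoff : ∀ k → Player → Fin k → Fin k → ℚ
payoff k rowP i j = D k i j
payoff k colP i j = D k j i

record Mixed (k : ℕ) : Set where
  field
    prob   : Fin k → ℚ
    nonneg : ∀ i → 0ℚ ≤ prob i
    total  : sumFin prob ≡ 1ℚ
open Mixed public

Profile : ℕ → Set
Profile k = Player → Mixed k

SameMixed : ∀ {k} → Mixed k → Mixed k → Set
SameMixed s t = ∀ i → prob s i ≡ prob t i

SameProfile : ∀ {k} → Profile k → Profile k → Set
SameProfile σ τ = ∀ p → SameMixed (σ p) (τ p)

U : ∀ k → Player → Profile k → ℚ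
U k p σ = sumFin (λ i → sumFin (λ j →
            prob (σ rowP) i * prob (σ colP) j * payoff k p i j))

deviate : ∀ {k} → Profile k → Player → Mixed k → Profile k
deviate σ rowP τ rowP = τ
deviate σ rowP τ colP = σ colP
deviate σ colP τ rowP = σ rowP
deviate σ colP τ colP = τ

IsNE : ∀ k → Profile k → Set
IsNE k σ = ∀ p (τ : Mixed k) → U k p (deviate σ p τ) ≤ U k p σ

Symmetric : ∀ {k} → Profile k → Set
Symmetric σ = SameMixed (σ rowP) (σ colP)

ParetoOptimal : ∀ k → Profile k → Set
ParetoOptimal k σ = ∀ (τ : Profile k) →
  ¬ ((∀ p → U k p σ ≤ U k p τ) × (∃ λ p → U k p σ < U k p τ))

StronglyParetoOptimal : ∀ k → Profile k → Set
StronglyParetoOptimal k σ = ∀ (τ : Profile k) →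
  (∃ λ p → U k p σ < U k p τ) →
  ∃ λ j → ¬ SameMixed (σ j) (τ j) × ¬ (U k j σ < U k j τ)

{-# OPTIONS --safe #-}
module Submission where

-- Every payoff of the diagonal game is 0 or 1, so utilities are at most 1, and
-- strategy 0 guarantees utility 1 to either player because the first row of D_k
-- is all ones. Hence in every equilibrium both players get exactly 1, which no
-- profile can improve on; and utility 1 for both forces the joint distribution
-- onto the cells where D_k and D_kᵀ are both 1, i.e. onto the diagonal. A product
-- distribution supported on the diagonal is a point mass ⟨m,m⟩, and each of the k
-- pure diagonal profiles is indeed an equilibrium.

open import Defs
open import Data.Nat using (ℕ; _≥_; zero; suc; z≤n)
import Data.Nat as ℕ
import Data.Nat.Properties as ℕ
open import Data.Fin using (Fin; zero; suc; toℕ; _≟_)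
open import Data.Fin.Properties using (toℕ-injective; suc-injective)
open import Data.Rational
  using (ℚ; 0ℚ; 1ℚ; _+_; _*_; _≤_; _<_; 1/_; nonNegative; positive; ≢-nonZero)
  renaming (_≟_ to _≟ℚ_)
open import Data.Rational.Properties hiding (_≟_)
open import Data.Product using (Σ; ∃; _×_; _,_; proj₁; proj₂)
open import Data.Sum using (_⊎_; inj₁; inj₂)
open import Data.Empty using (⊥-elim)
open import Function using (_∘_)
open import Relation.Nullary using (¬_; yes; no; contradiction)
open import Relation.Binary.PropositionalEquality

0≤1 : 0ℚ ≤ 1ℚ
0≤1 = <⇒≤ (positive⁻¹ 1ℚ)

p≢0∧p*q≡0⇒q≡0 : ∀ {p q} → p ≢ 0ℚ → p * q ≡ 0ℚ → q ≡ 0ℚ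
p≢0∧p*q≡0⇒q≡0 {p} {q} p≢0 pq≡0 = begin
  q                 ≡⟨ *-identityˡ q ⟨
  1ℚ * q            ≡⟨ cong (_* q) (*-inverseˡ p) ⟨
  (1/ p) * p * q    ≡⟨ *-assoc (1/ p) p q ⟩
  (1/ p) * (p * q)  ≡⟨ cong ((1/ p) *_) pq≡0 ⟩
  (1/ p) * 0ℚ       ≡⟨ *-zeroʳ (1/ p) ⟩
  0ℚ                ∎
  where
    open ≡-Reasoning
    instance _ = ≢-nonZero p≢0

p≥0∧q≥0⇒p*q≥0 : ∀ {p q} → 0ℚ ≤ p → 0ℚ ≤ q → 0ℚ ≤ p * q
p≥0∧q≥0⇒p*q≥0 {p} {q} 0≤p 0≤q =
  nonNegative⁻¹ (p * q) {{nonNeg*nonNeg⇒nonNeg p {{nonNegative 0≤p}} q {{nonNegative 0≤q}}}}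

p≥0∧p≢0⇒p>0 : ∀ {p} → 0ℚ ≤ p → p ≢ 0ℚ → 0ℚ < p
p≥0∧p≢0⇒p>0 {p} 0≤p p≢0 =
  positive⁻¹ p {{nonNeg∧nonZero⇒pos p {{nonNegative 0≤p}} {{≢-nonZero p≢0}}}}

p≤1⇒q*p≤q : ∀ {p q} → 0ℚ ≤ q → p ≤ 1ℚ → q * p ≤ q
p≤1⇒q*p≤q {p} {q} 0≤q p≤1 = begin
  q * p   ≤⟨ *-monoˡ-≤-nonNeg q {{nonNegative 0≤q}} p≤1 ⟩
  q * 1ℚ  ≡⟨ *-identityʳ q ⟩
  q       ∎
  where open ≤-Reasoning

p<1⇒q*p<q : ∀ {p q} → 0ℚ < q → p < 1ℚ → q * p < q
p<1⇒q*p<q {p} {q} 0<q p<1 = begin-strict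
  q * p   <⟨ *-monoʳ-<-pos q {{positive 0<q}} p<1 ⟩
  q * 1ℚ  ≡⟨ *-identityʳ q ⟩
  q       ∎
  where open ≤-Reasoning

sumFin-cong : ∀ {k} {f g : Fin k → ℚ} → (∀ i → f i ≡ g i) → sumFin f ≡ sumFin g
sumFin-cong {zero}  f≗g = refl
sumFin-cong {suc k} f≗g = cong₂ _+_ (f≗g zero) (sumFin-cong (f≗g ∘ suc))

sumFin-*ˡ : ∀ {k} c (f : Fin k → ℚ) → sumFin (λ i → c * f i) ≡ c * sumFin f
sumFin-*ˡ {zero}  c f = sym (*-zeroʳ c)
sumFin-*ˡ {suc k} c f =
  trans (cong (c * f zero +_) (sumFin-*ˡ c (f ∘ suc))) (sym (*-distribˡ-+ c _ _))

sumFin-mono-≤ : ∀ {k} {f g : Fin k → ℚ} → (∀ i → f i ≤ g i) → sumFin f ≤ sumFin g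
sumFin-mono-≤ {zero}  f≤g = ≤-refl
sumFin-mono-≤ {suc k} f≤g = +-mono-≤ (f≤g zero) (sumFin-mono-≤ (f≤g ∘ suc))

sumFin-mono-< : ∀ {k} {f g : Fin k → ℚ} → (∀ i → f i ≤ g i) →
                ∀ m → f m < g m → sumFin f < sumFin g
sumFin-mono-< f≤g zero    fm<gm = +-mono-<-≤ fm<gm (sumFin-mono-≤ (f≤g ∘ suc))
sumFin-mono-< f≤g (suc m) fm<gm = +-mono-≤-< (f≤g zero) (sumFin-mono-< (f≤g ∘ suc) m fm<gm)

sumFin-zero : ∀ {k} {f : Fin k → ℚ} → (∀ i → f i ≡ 0ℚ) → sumFin f ≡ 0ℚ
sumFin-zero {zero}  f≡0 = refl
sumFin-zero {suc k} f≡0 = cong₂ _+_ (f≡0 zero) (sumFin-zero (f≡0 ∘ suc))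

sumFin-single : ∀ {k} (f : Fin k → ℚ) m → (∀ j → j ≢ m → f j ≡ 0ℚ) → sumFin f ≡ f m
sumFin-single f zero f≡0 =
  trans (cong (f zero +_) (sumFin-zero (λ j → f≡0 (suc j) λ ()))) (+-identityʳ (f zero))
sumFin-single f (suc m) f≡0 =
  trans (cong (_+ sumFin (f ∘ suc)) (f≡0 zero λ ()))
    (trans (+-identityˡ _) (sumFin-single (f ∘ suc) m (λ j j≢m → f≡0 (suc j) (j≢m ∘ suc-injective))))

sumFin-≢0 : ∀ {k} (f : Fin k → ℚ) → sumFin f ≢ 0ℚ → ∃ λ i → f i ≢ 0ℚ
sumFin-≢0 {zero}  f Σ≢0 = contradiction refl Σ≢0
sumFin-≢0 {suc k} f Σ≢0 with f zero ≟ℚ 0ℚ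
... | no  f0≢0 = zero , f0≢0
... | yes f0≡0 with sumFin-≢0 (f ∘ suc) (λ Σ≡0 → Σ≢0 (cong₂ _+_ f0≡0 Σ≡0))
...   | i , fi≢0 = suc i , fi≢0

joint : ∀ {k} → Profile k → Fin k → Fin k → ℚ
joint σ i j = prob (σ rowP) i * prob (σ colP) j

-- U k p σ is definitionally expected σ (payoff k p).
expected : ∀ {k} → Profile k → (Fin k → Fin k → ℚ) → ℚ
expected σ a = sumFin λ i → sumFin λ j → joint σ i j * a i j

joint-nonneg : ∀ {k} (σ : Profile k) i j → 0ℚ ≤ joint σ i j
joint-nonneg σ i j = p≥0∧q≥0⇒p*q≥0 (nonneg (σ rowP) i) (nonneg (σ colP) j)

joint-zeroˡ : ∀ {k} (σ : Profile k) i j → prob (σ rowP) i ≡ 0ℚ → joint σ i j ≡ 0ℚ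
joint-zeroˡ σ i j x≡0 = trans (cong (_* prob (σ colP) j) x≡0) (*-zeroˡ (prob (σ colP) j))

joint-zeroʳ : ∀ {k} (σ : Profile k) i j → prob (σ colP) j ≡ 0ℚ → joint σ i j ≡ 0ℚ
joint-zeroʳ σ i j y≡0 = trans (cong (prob (σ rowP) i *_) y≡0) (*-zeroʳ (prob (σ rowP) i))

joint-total : ∀ {k} (σ : Profile k) → sumFin (λ i → sumFin (joint σ i)) ≡ 1ℚ
joint-total σ = begin
  sumFin (λ i → sumFin (λ j → x i * y j))  ≡⟨ sumFin-cong (λ i → sumFin-*ˡ (x i) y) ⟩
  sumFin (λ i → x i * sumFin y)            ≡⟨ sumFin-cong (λ i → cong (x i *_) (total (σ colP))) ⟩
  sumFin (λ i → x i * 1ℚ)                  ≡⟨ sumFin-cong (λ i → *-identityʳ (x i)) ⟩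
  sumFin x                                 ≡⟨ total (σ rowP) ⟩
  1ℚ                                       ∎
  where
    open ≡-Reasoning
    x = prob (σ rowP)
    y = prob (σ colP)

module _ {k} (σ : Profile k) {a : Fin k → Fin k → ℚ} (a≤1 : ∀ i j → a i j ≤ 1ℚ) where

  private
    weighted≤joint : ∀ i j → joint σ i j * a i j ≤ joint σ i j
    weighted≤joint i j = p≤1⇒q*p≤q (joint-nonneg σ i j) (a≤1 i j)

  expected-≤-1 : expected σ a ≤ 1ℚ
  expected-≤-1 = begin
    expected σ a                        ≤⟨ sumFin-mono-≤ (λ i → sumFin-mono-≤ (weighted≤joint i)) ⟩
    sumFin (λ i → sumFin (joint σ i))  ≡⟨ joint-total σ ⟩
    1ℚ                                  ∎
    where open ≤-Reasoning

  expected-<-1 : ∀ i j → joint σ i j ≢ 0ℚ → a i j < 1ℚ → expected σ a < 1ℚ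
  expected-<-1 i j w≢0 aij<1 = begin-strict
    expected σ a                        <⟨ sumFin-mono-< (λ i → sumFin-mono-≤ (weighted≤joint i)) i
                                             (sumFin-mono-< (weighted≤joint i) j (p<1⇒q*p<q 0<w aij<1)) ⟩
    sumFin (λ i → sumFin (joint σ i))  ≡⟨ joint-total σ ⟩
    1ℚ                                  ∎
    where
      open ≤-Reasoning
      0<w : 0ℚ < joint σ i j
      0<w = p≥0∧p≢0⇒p>0 (joint-nonneg σ i j) w≢0

  expected≡1⇒joint≡0 : expected σ a ≡ 1ℚ → ∀ i j → a i j < 1ℚ → joint σ i j ≡ 0ℚ
  expected≡1⇒joint≡0 E≡1 i j aij<1 with joint σ i j ≟ℚ 0ℚ
  ... | yes w≡0 = w≡0
  ... | no  w≢0 = contradiction E≡1 (<⇒≢ (expected-<-1 i j w≢0 aij<1))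

expected-≡-1 : ∀ {k} (σ : Profile k) {a : Fin k → Fin k → ℚ} →
               (∀ i j → joint σ i j ≡ 0ℚ ⊎ a i j ≡ 1ℚ) → expected σ a ≡ 1ℚ
expected-≡-1 σ {a} w≡0∨a≡1 =
  trans (sumFin-cong λ i → sumFin-cong λ j → weighted≡joint i j (w≡0∨a≡1 i j)) (joint-total σ)
  where
    weighted≡joint : ∀ i j → joint σ i j ≡ 0ℚ ⊎ a i j ≡ 1ℚ → joint σ i j * a i j ≡ joint σ i j
    weighted≡joint i j (inj₁ w≡0) = trans (cong (_* a i j) w≡0) (trans (*-zeroˡ (a i j)) (sym w≡0))
    weighted≡joint i j (inj₂ a≡1) = trans (cong (joint σ i j *_) a≡1) (*-identityʳ _)

δ : ∀ {k} → Fin k → Fin k → ℚ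
δ zero    zero    = 1ℚ
δ zero    (suc _) = 0ℚ
δ (suc _) zero    = 0ℚ
δ (suc i) (suc j) = δ i j

δ-diag : ∀ {k} (i : Fin k) → δ i i ≡ 1ℚ
δ-diag zero    = refl
δ-diag (suc i) = δ-diag i

δ-≢ : ∀ {k} {i j : Fin k} → i ≢ j → δ i j ≡ 0ℚ
δ-≢ {i = zero}  {zero}  i≢j = contradiction refl i≢j
δ-≢ {i = zero}  {suc j} i≢j = refl
δ-≢ {i = suc i} {zero}  i≢j = refl
δ-≢ {i = suc i} {suc j} i≢j = δ-≢ (i≢j ∘ cong suc)

δ-nonneg : ∀ {k} (i j : Fin k) → 0ℚ ≤ δ i j
δ-nonneg i j with i ≟ j
... | yes refl = subst (0ℚ ≤_) (sym (δ-diag i)) 0≤1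
... | no  i≢j  = ≤-reflexive (sym (δ-≢ i≢j))

pure : ∀ {k} → Fin k → Mixed k
pure m = record
  { prob   = λ i → δ i m
  ; nonneg = λ i → δ-nonneg i m
  ; total  = trans (sumFin-single (λ i → δ i m) m (λ _ → δ-≢)) (δ-diag m)
  }

pureProfile : ∀ {k} → Fin k → Profile k
pureProfile m _ = pure m

pureProfile-injective : ∀ {k} (i j : Fin k) → SameProfile (pureProfile i) (pureProfile j) → i ≡ j
pureProfile-injective i j same with i ≟ j
... | yes i≡j = i≡j
... | no  i≢j = contradiction (trans (sym (δ-diag i)) (trans (same rowP i) (δ-≢ i≢j))) 1≢0

supported⇒SameMixed-pure : ∀ {k} (s : Mixed k) m → (∀ i → i ≢ m → prob s i ≡ 0ℚ) →
                           SameMixed s (pure m)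
supported⇒SameMixed-pure s m off≡0 i with i ≟ m
... | yes refl = trans (sym (sumFin-single (prob s) i off≡0)) (trans (total s) (sym (δ-diag i)))
... | no  i≢m  = trans (off≡0 i i≢m) (sym (δ-≢ i≢m))

-- Pick m with s m ≠ 0: then t vanishes off m, so t m = 1, so s vanishes off m.
offDiagonal≡0⇒pure : ∀ {k} (s t : Mixed k) → (∀ i j → i ≢ j → prob s i * prob t j ≡ 0ℚ) →
                     ∃ λ m → SameMixed s (pure m) × SameMixed t (pure m)
offDiagonal≡0⇒pure s t off≡0 = m , s≗δ , t≗δ
  where
    s-support : ∃ λ m → prob s m ≢ 0ℚ
    s-support = sumFin-≢0 (prob s) (λ Σs≡0 → 1≢0 (trans (sym (total s)) Σs≡0))
    m = proj₁ s-support

    t≗δ : SameMixed t (pure m)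
    t≗δ = supported⇒SameMixed-pure t m λ j j≢m →
      p≢0∧p*q≡0⇒q≡0 (proj₂ s-support) (off≡0 m j (≢-sym j≢m))

    t-m≢0 : prob t m ≢ 0ℚ
    t-m≢0 tm≡0 = 1≢0 (trans (sym (δ-diag m)) (trans (sym (t≗δ m)) tm≡0))

    s≗δ : SameMixed s (pure m)
    s≗δ = supported⇒SameMixed-pure s m λ i i≢m →
      p≢0∧p*q≡0⇒q≡0 t-m≢0 (trans (*-comm (prob t m) (prob s i)) (off≡0 i m i≢m))

D-≤-1 : ∀ k (i j : Fin k) → D k i j ≤ 1ℚ
D-≤-1 k i j with toℕ i ℕ.≤? toℕ j
... | yes _ = ≤-refl
... | no  _ = 0≤1

D≡1 : ∀ {k} {i j : Fin k} → toℕ i ℕ.≤ toℕ j → D k i j ≡ 1ℚ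
D≡1 {k} {i} {j} i≤j with toℕ i ℕ.≤? toℕ j
... | yes _   = refl
... | no  i≰j = contradiction i≤j i≰j

D<1 : ∀ {k} {i j : Fin k} → ¬ toℕ i ℕ.≤ toℕ j → D k i j < 1ℚ
D<1 {k} {i} {j} i≰j with toℕ i ℕ.≤? toℕ j
... | yes i≤j = contradiction i≤j i≰j
... | no  _   = positive⁻¹ 1ℚ

payoff-≤-1 : ∀ k p (i j : Fin k) → payoff k p i j ≤ 1ℚ
payoff-≤-1 k rowP i j = D-≤-1 k i j
payoff-≤-1 k colP i j = D-≤-1 k j i

payoff-diag : ∀ k p (i : Fin k) → payoff k p i i ≡ 1ℚ
payoff-diag k rowP i = D≡1 {i = i} ℕ.≤-refl
payoff-diag k colP i = D≡1 {i = i} ℕ.≤-refl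

U-≤-1 : ∀ k p (σ : Profile k) → U k p σ ≤ 1ℚ
U-≤-1 k p σ = expected-≤-1 σ (payoff-≤-1 k p)

U≡1⇒improvement-impossible : ∀ {k} p (σ τ : Profile k) → U k p σ ≡ 1ℚ → ¬ U k p σ < U k p τ
U≡1⇒improvement-impossible {k} p σ τ σ≡1 σ<τ =
  <-irrefl refl (<-≤-trans (subst (_< U k p τ) σ≡1 σ<τ) (U-≤-1 k p τ))

U≡1⇒IsNE : ∀ {k} (σ : Profile k) → (∀ p → U k p σ ≡ 1ℚ) → IsNE k σ
U≡1⇒IsNE {k} σ σ≡1 p τ =
  subst (U k p (deviate σ p τ) ≤_) (sym (σ≡1 p)) (U-≤-1 k p (deviate σ p τ))

U≡1⇒ParetoOptimal : ∀ {k} (σ : Profile k) → (∀ p → U k p σ ≡ 1ℚ) → ParetoOptimal k σ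
U≡1⇒ParetoOptimal σ σ≡1 τ (_ , p , σ<τ) = U≡1⇒improvement-impossible p σ τ (σ≡1 p) σ<τ

U≡1⇒StronglyParetoOptimal : ∀ {k} (σ : Profile k) → (∀ p → U k p σ ≡ 1ℚ) →
                            StronglyParetoOptimal k σ
U≡1⇒StronglyParetoOptimal σ σ≡1 τ (p , σ<τ) =
  ⊥-elim (U≡1⇒improvement-impossible p σ τ (σ≡1 p) σ<τ)

U-pureProfile : ∀ k (m : Fin k) p → U k p (pureProfile m) ≡ 1ℚ
U-pureProfile k m p = expected-≡-1 (pureProfile m) diagonal
  where
    diagonal : ∀ i j → joint (pureProfile m) i j ≡ 0ℚ ⊎ payoff k p i j ≡ 1ℚ
    diagonal i j with i ≟ m | j ≟ m
    ... | no  i≢m | _        = inj₁ (joint-zeroˡ (pureProfile m) i j (δ-≢ i≢m))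
    ... | yes _   | no  j≢m  = inj₁ (joint-zeroʳ (pureProfile m) i j (δ-≢ j≢m))
    ... | yes refl | yes refl = inj₂ (payoff-diag k p i)

U-deviate-zero : ∀ {n} (σ : Profile (suc n)) p → U (suc n) p (deviate σ p (pure zero)) ≡ 1ℚ
U-deviate-zero σ p = expected-≡-1 (deviate σ p (pure zero)) (first-row p)
  where
    first-row : ∀ p i j → joint (deviate σ p (pure zero)) i j ≡ 0ℚ ⊎ payoff _ p i j ≡ 1ℚ
    first-row rowP zero    j       = inj₂ (D≡1 {i = zero} {j} z≤n)
    first-row rowP (suc i) j       = inj₁ (joint-zeroˡ (deviate σ rowP (pure zero)) (suc i) j refl)
    first-row colP i       zero    = inj₂ (D≡1 {i = zero} {i} z≤n)
    first-row colP i       (suc j) = inj₁ (joint-zeroʳ (deviate σ colP (pure zero)) i (suc j) refl)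

IsNE⇒U≡1 : ∀ {n} (σ : Profile (suc n)) → IsNE (suc n) σ → ∀ p → U (suc n) p σ ≡ 1ℚ
IsNE⇒U≡1 {n} σ ne p = ≤-antisym (U-≤-1 _ p σ)
  (subst (_≤ U (suc n) p σ) (U-deviate-zero σ p) (ne p (pure zero)))

IsNE⇒offDiagonal≡0 : ∀ {n} (σ : Profile (suc n)) → IsNE (suc n) σ →
                     ∀ i j → i ≢ j → joint σ i j ≡ 0ℚ
IsNE⇒offDiagonal≡0 {n} σ ne i j i≢j with toℕ i ℕ.≤? toℕ j
... | yes i≤j = expected≡1⇒joint≡0 σ (payoff-≤-1 _ colP) (IsNE⇒U≡1 σ ne colP) i j
                  (D<1 λ j≤i → i≢j (toℕ-injective (ℕ.≤-antisym i≤j j≤i)))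
... | no  i≰j = expected≡1⇒joint≡0 σ (payoff-≤-1 _ rowP) (IsNE⇒U≡1 σ ne rowP) i j (D<1 i≰j)

IsNE⇒pureProfile : ∀ {n} (σ : Profile (suc n)) → IsNE (suc n) σ →
                   ∃ λ m → SameProfile σ (pureProfile m)
IsNE⇒pureProfile σ ne =
  let m , row≗δ , col≗δ = offDiagonal≡0⇒pure (σ rowP) (σ colP) (IsNE⇒offDiagonal≡0 σ ne)
  in m , λ { rowP → row≗δ ; colP → col≗δ }

IsNE⇒Symmetric : ∀ {n} (σ : Profile (suc n)) → IsNE (suc n) σ → Symmetric σ
IsNE⇒Symmetric σ ne i =
  let _ , σ≗δ = IsNE⇒pureProfile σ ne
  in trans (σ≗δ rowP i) (sym (σ≗δ colP i))

mainTheorem14 : (k : ℕ) → k ≥ 1 →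
    (Σ (Fin k → Profile k) λ e →
        (∀ i → IsNE k (e i))
      × (∀ i j → SameProfile (e i) (e j) → i ≡ j)
      × (∀ σ → IsNE k σ → ∃ λ i → SameProfile σ (e i)))
    × (∀ σ → IsNE k σ →
          ParetoOptimal k σ
        × StronglyParetoOptimal k σ
        × Symmetric σ
        × U k rowP σ ≡ 1ℚ
        × U k colP σ ≡ 1ℚ)
mainTheorem14 (suc n) _ =
    ( pureProfile
    , (λ m → U≡1⇒IsNE (pureProfile m) (U-pureProfile (suc n) m))
    , pureProfile-injective
    , IsNE⇒pureProfile)
  , λ σ ne →
      let σ≡1 = IsNE⇒U≡1 σ ne in
        U≡1⇒ParetoOptimal σ σ≡1
      , U≡1⇒StronglyParetoOptimal σ σ≡1
      , IsNE⇒Symmetric σ ne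
      , σ≡1 rowP
      , σ≡1 colP
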